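{- Let $n_1, n_2, n_3$ be pairwise coprime positive integers which minimally generate the numerical semigroup $\langle n_1,n_2,n_3\rangle$ (i.e. none of them lies in the monoid generated by the other two), and let $\{i,j,k\} = \{1,2,3\}$. Put $\lambda_{ij} = [-n_i n_j^{ -1}]_{n_k}$, $\lambda_{ik} = [-n_i n_k^{ -1}]_{n_j}$, and $N_i = n_j n_k - \lambda_{ij} n_j - n_k$. Define $$\mathcal{S}_k = \{ M \in \mathbb{N}\setminus\{0\} \mid M n_k \in \langle n_j, n_i\rangle\},\qquad \mathcal{T}_k = \{ M \in \mathbb{N}\setminus\{0\} \mid M n_k \in \langle n_j, N_i\rangle\}.$$ Then $$\mathcal{S}_k = \{ x - (\lambda_{ik} - 1)[-x]_{n_j} \mid x \in \mathcal{T}_k \}.$$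
   Context: $\mathbb{N}$ denotes the nonnegative integers; $\langle a_1,\dots,a_r\rangle$ denotes the set of $\mathbb{N}$-linear combinations of $a_1,\dots,a_r$. For integers $m$ and $n>0$, $[m]_n$ denotes the remainder of the Euclidean division of $m$ by $n$ (so $0 \le [m]_n < n$); for $b$ coprime to $n$, $[a b^{ -1}]_n$ denotes the remainder modulo $n$ of $a$ times a multiplicative inverse of $b$ modulo $n$. Under the hypotheses, $\lambda_{ij},\lambda_{ik}$ are positive integers with $n_i = n_j n_k - \lambda_{ij} n_j - \lambda_{ik} n_k$, so that $N_i - (\lambda_{ik}-1)n_k = n_i$. -}

module Defs where

open import Data.Nat using (ℕ; zero; suc; _+_; _*_)
open import Data.Integer as ℤ using (ℤ; +_; -_)
open import Data.Integer.DivMod using (_%ℕ_)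
open import Data.Product using (∃₂)
open import Relation.Binary.PropositionalEquality using (_≡_)

-- [m]_n : remainder of Euclidean division of the integer m by n > 0
-- (value for n = 0 is a dummy 0, never used under the hypotheses)
rem : ℤ → ℕ → ℕ
rem m zero    = 0
rem m (suc n) = m %ℕ (suc n)

InMonoid2 : ℕ → ℕ → ℕ → Set
InMonoid2 a b m = ∃₂ λ u v → u * a + v * b ≡ m

InMonoid2ℤ : ℕ → ℤ → ℕ → Set
InMonoid2ℤ a B m = ∃₂ λ u v → (+ u) ℤ.* (+ a) ℤ.+ (+ v) ℤ.* B ≡ + m

{-# OPTIONS --safe #-}
module Submission where

-- Write λik = 1 + l. Since ni ∉ ⟨nj, nk⟩, the two congruences defining λij and λik force
-- ni + λij nj + λik nk = nj nk, so Ni = ni + l nk. In a representation M nk = u nj + v ni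
-- one may take v < nj, and then x = M + l v satisfies x nk = u nj + v Ni; conversely every
-- such representation of x nk with v < nj comes from M = x − l v. As nj divides ni + λik nk,
-- it divides (x + v) nk, hence x + v, so v = [−x]_nj and M = x − l [−x]_nj.

open import Defs
open import Data.Nat using (ℕ; zero; suc; _+_; _*_; _∸_; _<_; _>_; _≤_; z≤n; s≤s; NonZero; >-nonZero)
open import Data.Nat.Properties
open import Data.Nat.DivMod using (_%_; _/_; m≡m%n+[m/n]*n; m%n<n)
open import Data.Nat.Divisibility using (_∣_; divides; ∣-refl; ∣m+n∣m⇒∣n; ∣m∣n⇒∣m+n; n∣m*n; ∣n⇒∣m*n; >⇒∤)
open import Data.Nat.Coprimality using (Coprime; coprime-divisor)
import Data.Nat.Tactic.RingSolver as ℕ-Solver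
open import Data.Integer as ℤ using (ℤ; +_; -_)
import Data.Integer.Properties as ℤ
import Data.Integer.Tactic.RingSolver as ℤ-Solver
open import Data.Product using (_×_; _,_; ∃; ∃₂)
open import Data.Empty using (⊥-elim)
open import Function using (_∘_)
open import Relation.Nullary using (¬_; contradiction)
open import Relation.Binary.PropositionalEquality using (_≡_; refl; sym; trans; cong; cong₂; subst; module ≡-Reasoning)

∣-residue⇒≡0 : ∀ {d r} → r < d → d ∣ r → r ≡ 0
∣-residue⇒≡0 {r = zero}  _   _   = refl
∣-residue⇒≡0 {r = suc _} r<d d∣r = contradiction d∣r (>⇒∤ r<d)

∣-residue-sum⇒≡ : ∀ {d m n} → m < d → n < d → 0 < m + n → d ∣ m + n → m + n ≡ d
∣-residue-sum⇒≡ _ _ 0<m+n (divides zero m+n≡0) = contradiction (subst (0 <_) m+n≡0 0<m+n) (<-irrefl refl)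
∣-residue-sum⇒≡ {d} _ _ _ (divides 1 m+n≡1*d) = trans m+n≡1*d (*-identityˡ d)
∣-residue-sum⇒≡ {d} m<d n<d _ (divides (suc (suc q)) m+n≡[2+q]*d) =
  contradiction (+-mono-< m<d n<d)
    (≤⇒≯ (subst (d + d ≤_) (sym m+n≡[2+q]*d) (+-monoʳ-≤ d (m≤m+n d (q * d)))))

∣m+n⇒∣m%d+n : ∀ {d} m {n} .{{_ : NonZero d}} → d ∣ m + n → d ∣ m % d + n
∣m+n⇒∣m%d+n {d} m {n} d∣m+n = ∣m+n∣m⇒∣n (subst (d ∣_) m+n≡ d∣m+n) (n∣m*n (m / d))
  where
  m+n≡ : m + n ≡ m / d * d + (m % d + n)
  m+n≡ = trans (cong (_+ n) (trans (m≡m%n+[m/n]*n m d) (+-comm (m % d) _))) (+-assoc _ (m % d) n)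

rem-neg : ∀ {d} x {r} → r < d → d ∣ x + r → rem (- (+ x)) d ≡ r
rem-neg {suc _} zero    r<d d∣r = sym (∣-residue⇒≡0 r<d d∣r)
rem-neg {suc a} (suc y) {r} r<d d∣x+r
  with suc y % suc a | m%n<n (suc y) (suc a) | ∣m+n⇒∣m%d+n (suc y) d∣x+r
... | zero  | _   | d∣r   = sym (∣-residue⇒≡0 r<d d∣r)
... | suc s | s<d | d∣s+r =
  trans (cong (_∸ suc s) (sym (∣-residue-sum⇒≡ s<d r<d (s≤s z≤n) d∣s+r))) (m+n∸m≡n (suc s) r)

coprime-divisor⇒InMonoid2 : ∀ {n d e} → Coprime n d → d ∣ n → InMonoid2 d e n
coprime-divisor⇒InMonoid2 {n} {d} n⊥d d∣n =
  n , 0 , trans (+-identityʳ (n * d)) (trans (cong (n *_) (n⊥d (d∣n , ∣-refl))) (*-identityʳ n))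

InMonoid2-from-excess : ∀ {a b c n t} → c < b → n + c * a ≡ t * b → a ≤ t → InMonoid2 a b n
InMonoid2-from-excess {a} {b} {c} {n} {t} c<b n+c*a≡t*b a≤t =
  b ∸ c , t ∸ a , +-cancelʳ-≡ (c * a) ((b ∸ c) * a + (t ∸ a) * b) n (begin
    (b ∸ c) * a + (t ∸ a) * b + c * a ≡⟨ regroupˡ (b ∸ c) a (t ∸ a) b c ⟩
    (b ∸ c + c) * a + (t ∸ a) * b     ≡⟨ cong (λ z → z * a + (t ∸ a) * b) (m∸n+n≡m (<⇒≤ c<b)) ⟩
    b * a + (t ∸ a) * b               ≡⟨ regroupʳ b a (t ∸ a) ⟩
    (t ∸ a + a) * b                   ≡⟨ cong (_* b) (m∸n+n≡m a≤t) ⟩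
    t * b                             ≡⟨ n+c*a≡t*b ⟨
    n + c * a                         ∎)
  where
  open ≡-Reasoning
  regroupˡ : ∀ p a q b c → p * a + q * b + c * a ≡ (p + c) * a + q * b
  regroupˡ = ℕ-Solver.solve-∀
  regroupʳ : ∀ b a q → b * a + q * b ≡ (q + a) * b
  regroupʳ = ℕ-Solver.solve-∀

ni+λij*nj+λik*nk≡nj*nk : ∀ {ni nj nk λij λik} →
  0 < ni → Coprime nj nk → ¬ InMonoid2 nj nk ni →
  λij < nk → nk ∣ ni + λij * nj → λik < nj → nj ∣ ni + λik * nk →
  ni + λij * nj + λik * nk ≡ nj * nk
ni+λij*nj+λik*nk≡nj*nk {ni} {nj} {nk} {λij} {λik}
  0<ni nj⊥nk ni∉⟨nj,nk⟩ λij<nk (divides t ni+λij*nj≡t*nk) λik<nj nj∣ni+λik*nk =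
  trans S≡ (cong (_* nk) t+λik≡nj)
  where
  S≡ : ni + λij * nj + λik * nk ≡ (t + λik) * nk
  S≡ = trans (cong (_+ λik * nk) ni+λij*nj≡t*nk) (sym (*-distribʳ-+ nk t λik))
  t<nj : t < nj
  t<nj = ≰⇒> (λ nj≤t → ni∉⟨nj,nk⟩ (InMonoid2-from-excess λij<nk ni+λij*nj≡t*nk nj≤t))
  nj∣S : nj ∣ ni + λij * nj + λik * nk
  nj∣S = subst (nj ∣_) (+-comm-middle ni (λij * nj) (λik * nk)) (∣m∣n⇒∣m+n (n∣m*n λij) nj∣ni+λik*nk)
    where
    +-comm-middle : ∀ a b c → b + (a + c) ≡ a + b + c
    +-comm-middle = ℕ-Solver.solve-∀
  0<S : 0 < ni + λij * nj + λik * nk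
  0<S = <-≤-trans 0<ni (≤-trans (m≤m+n ni (λij * nj)) (m≤m+n (ni + λij * nj) (λik * nk)))
  0<t+λik : 0 < t + λik
  0<t+λik = n≢0⇒n>0 λ t+λik≡0 → <⇒≢ 0<S (sym (trans S≡ (cong (_* nk) t+λik≡0)))
  t+λik≡nj : t + λik ≡ nj
  t+λik≡nj = ∣-residue-sum⇒≡ t<nj λik<nj 0<t+λik
               (coprime-divisor nj⊥nk (subst (nj ∣_) (trans S≡ (*-comm (t + λik) nk)) nj∣S))

pos-+-* : ∀ m c a → + (m + c * a) ≡ + m ℤ.+ + c ℤ.* + a
pos-+-* m c a = trans (ℤ.pos-+ m (c * a)) (cong (ℤ._+_ (+ m)) (ℤ.pos-* c a))

pos-*-+-* : ∀ u a v b → + (u * a + v * b) ≡ + u ℤ.* + a ℤ.+ + v ℤ.* + b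
pos-*-+-* u a v b = trans (ℤ.pos-+ (u * a) (v * b)) (cong₂ ℤ._+_ (ℤ.pos-* u a) (ℤ.pos-* v b))

a*b-c*a-b≡n+l*b : ∀ n a b c l → n + c * a + suc l * b ≡ a * b →
                  + a ℤ.* + b ℤ.- + c ℤ.* + a ℤ.- + b ≡ + (n + l * b)
a*b-c*a-b≡n+l*b n a b c l E = begin
  + a ℤ.* + b ℤ.- + c ℤ.* + a ℤ.- + b                              ≡⟨ cong (λ z → z ℤ.- + c ℤ.* + a ℤ.- + b) a*b≡ ⟩
  + n ℤ.+ + c ℤ.* + a ℤ.+ + suc l ℤ.* + b ℤ.- + c ℤ.* + a ℤ.- + b ≡⟨ cancel (+ n) (+ c) (+ a) (+ l) (+ b) ⟩
  + n ℤ.+ + l ℤ.* + b                                             ≡⟨ pos-+-* n l b ⟨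
  + (n + l * b)                                                   ∎
  where
  open ≡-Reasoning
  cancel : ∀ n c a l b → n ℤ.+ c ℤ.* a ℤ.+ (ℤ.+ 1 ℤ.+ l) ℤ.* b ℤ.- c ℤ.* a ℤ.- b ≡ n ℤ.+ l ℤ.* b
  cancel = ℤ-Solver.solve-∀
  a*b≡ : + a ℤ.* + b ≡ + n ℤ.+ + c ℤ.* + a ℤ.+ + suc l ℤ.* + b
  a*b≡ = begin
    + a ℤ.* + b                             ≡⟨ ℤ.pos-* a b ⟨
    + (a * b)                               ≡⟨ cong +_ E ⟨
    + (n + c * a + suc l * b)               ≡⟨ ℤ.pos-+ (n + c * a) (suc l * b) ⟩
    + (n + c * a) ℤ.+ + (suc l * b)         ≡⟨ cong₂ ℤ._+_ (pos-+-* n c a) (ℤ.pos-* (suc l) b) ⟩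
    + n ℤ.+ + c ℤ.* + a ℤ.+ + suc l ℤ.* + b ∎

InMonoid2⇒InMonoid2ℤ : ∀ {a b m} → InMonoid2 a b m → InMonoid2ℤ a (+ b) m
InMonoid2⇒InMonoid2ℤ {a} {b} (u , v , u*a+v*b≡m) =
  u , v , trans (sym (pos-*-+-* u a v b)) (cong +_ u*a+v*b≡m)

InMonoid2ℤ⇒InMonoid2 : ∀ {a b m} → InMonoid2ℤ a (+ b) m → InMonoid2 a b m
InMonoid2ℤ⇒InMonoid2 {a} {b} (u , v , eq) = u , v , ℤ.+-injective (trans (pos-*-+-* u a v b) eq)

coefficient-exchange : ∀ u a r q g → (u + q * g) * a + r * g ≡ u * a + (r + q * a) * g
coefficient-exchange = ℕ-Solver.solve-∀

InMonoid2-reduce : ∀ {a g m} .{{_ : NonZero a}} → InMonoid2 a g m →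
                   ∃₂ λ u v → v < a × u * a + v * g ≡ m
InMonoid2-reduce {a} {g} (u , v , u*a+v*g≡m) =
  u + v / a * g , v % a , m%n<n v a ,
  trans (coefficient-exchange u a (v % a) (v / a) g)
        (trans (cong (λ w → u * a + w * g) (sym (m≡m%n+[m/n]*n v a))) u*a+v*g≡m)

spread-shift : ∀ w v n l b → w + v * (n + l * b) ≡ w + v * n + l * v * b
spread-shift = ℕ-Solver.solve-∀

absorb-generator : ∀ w v n l b → w + v * (n + l * b) + v * b ≡ w + v * (n + suc l * b)
absorb-generator = ℕ-Solver.solve-∀

shift-forward : ∀ u a v n l M b → u * a + v * n ≡ M * b →
                u * a + v * (n + l * b) ≡ (M + l * v) * b
shift-forward u a v n l M b u*a+v*n≡M*b = begin
  u * a + v * (n + l * b)   ≡⟨ spread-shift (u * a) v n l b ⟩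
  u * a + v * n + l * v * b ≡⟨ cong (_+ l * v * b) u*a+v*n≡M*b ⟩
  M * b + l * v * b         ≡⟨ *-distribʳ-+ b M (l * v) ⟨
  (M + l * v) * b           ∎
  where open ≡-Reasoning

shift-backward : ∀ u a v n l x b .{{_ : NonZero b}} → u * a + v * (n + l * b) ≡ x * b →
                 ∃ λ M → M + l * v ≡ x × u * a + v * n ≡ M * b
shift-backward u a v n l x b h = x ∸ l * v , M+l*v≡x , M*b≡
  where
  W = u * a + v * n
  x*b≡ : x * b ≡ W + l * v * b
  x*b≡ = trans (sym h) (spread-shift (u * a) v n l b)
  M+l*v≡x : x ∸ l * v + l * v ≡ x
  M+l*v≡x = m∸n+n≡m (*-cancelʳ-≤ (l * v) x b (subst (l * v * b ≤_) (sym x*b≡) (m≤n+m (l * v * b) W)))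
  M*b≡ : W ≡ (x ∸ l * v) * b
  M*b≡ = +-cancelʳ-≡ (l * v * b) W ((x ∸ l * v) * b)
    (trans (sym x*b≡) (trans (cong (_* b) (sym M+l*v≡x)) (*-distribʳ-+ b (x ∸ l * v) (l * v))))

positive-of-shift : ∀ u a v n l M b → 0 < n → 0 < M + l * v → u * a + v * n ≡ M * b → 0 < M
positive-of-shift _ _ _ _ _ (suc _) _ _ _ _ = s≤s z≤n
positive-of-shift u a v n l zero b 0<n 0<l*v u*a+v*n≡0 =
  contradiction (subst (0 <_) (trans (cong (l *_) v≡0) (*-zeroʳ l)) 0<l*v) (<-irrefl refl)
  where
  v≡0 : v ≡ 0
  v≡0 = m*n≡0⇒m≡0 v n {{>-nonZero 0<n}} (m+n≡0⇒n≡0 (u * a) u*a+v*n≡0)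

rem-neg-of-rep : ∀ {a b v} n l x u → Coprime a b → a ∣ n + suc l * b → v < a →
                 x * b ≡ u * a + v * (n + l * b) → rem (- (+ x)) a ≡ v
rem-neg-of-rep {a} {b} {v} n l x u a⊥b a∣ v<a x*b≡ =
  rem-neg x v<a (coprime-divisor a⊥b (subst (a ∣_) (*-comm (x + v) b) a∣[x+v]*b))
  where
  open ≡-Reasoning
  [x+v]*b≡ : (x + v) * b ≡ u * a + v * (n + suc l * b)
  [x+v]*b≡ = begin
    (x + v) * b                       ≡⟨ *-distribʳ-+ b x v ⟩
    x * b + v * b                     ≡⟨ cong (_+ v * b) x*b≡ ⟩
    u * a + v * (n + l * b) + v * b   ≡⟨ absorb-generator (u * a) v n l b ⟩
    u * a + v * (n + suc l * b)       ∎
  a∣[x+v]*b : a ∣ (x + v) * b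
  a∣[x+v]*b = subst (a ∣_) (sym [x+v]*b≡) (∣m∣n⇒∣m+n (n∣m*n u) (∣n⇒∣m*n v a∣))

toS : ℕ → ℕ → ℕ → ℤ
toS a c x = + x ℤ.- (+ c ℤ.- + 1) ℤ.* + rem (- (+ x)) a

toS[M+l*v]≡M : ∀ a M l v → rem (- (+ (M + l * v))) a ≡ v → + M ≡ toS a (suc l) (M + l * v)
toS[M+l*v]≡M a M l v rem≡v = begin
  + M                                   ≡⟨ cancel (+ M) (+ l) (+ v) ⟩
  + M ℤ.+ + l ℤ.* + v ℤ.- λik-1 ℤ.* + v ≡⟨ cong (λ z → z ℤ.- λik-1 ℤ.* + v) (pos-+-* M l v) ⟨
  + (M + l * v) ℤ.- λik-1 ℤ.* + v       ≡⟨ cong (λ r → + (M + l * v) ℤ.- λik-1 ℤ.* + r) rem≡v ⟨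
  toS a (suc l) (M + l * v)             ∎
  where
  open ≡-Reasoning
  λik-1 = + suc l ℤ.- + 1
  cancel : ∀ m l v → m ≡ m ℤ.+ l ℤ.* v ℤ.- ((ℤ.+ 1 ℤ.+ l) ℤ.- ℤ.+ 1) ℤ.* v
  cancel = ℤ-Solver.solve-∀

S⇒T : ∀ {ni nj nk l M} .{{_ : NonZero nj}} → Coprime nj nk → nj ∣ ni + suc l * nk →
      M > 0 → InMonoid2 nj ni (M * nk) →
      ∃ λ x → (x > 0 × InMonoid2 nj (ni + l * nk) (x * nk)) × + M ≡ toS nj (suc l) x
S⇒T {ni} {nj} {nk} {l} {M} nj⊥nk nj∣ 0<M M∈S with InMonoid2-reduce M∈S
... | u , v , v<nj , u*nj+v*ni≡M*nk =
  M + l * v , (≤-trans 0<M (m≤m+n M (l * v)) , u , v , x∈T) ,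
  toS[M+l*v]≡M nj M l v (rem-neg-of-rep ni l (M + l * v) u nj⊥nk nj∣ v<nj (sym x∈T))
  where
  x∈T : u * nj + v * (ni + l * nk) ≡ (M + l * v) * nk
  x∈T = shift-forward u nj v ni l M nk u*nj+v*ni≡M*nk

T⇒S : ∀ {ni nj nk l x} .{{_ : NonZero nj}} .{{_ : NonZero nk}} → 0 < ni →
      Coprime nj nk → nj ∣ ni + suc l * nk →
      x > 0 → InMonoid2 nj (ni + l * nk) (x * nk) →
      ∃ λ M → (M > 0 × InMonoid2 nj ni (M * nk)) × + M ≡ toS nj (suc l) x
T⇒S {ni} {nj} {nk} {l} {x} 0<ni nj⊥nk nj∣ 0<x x∈T with InMonoid2-reduce x∈T
... | u , v , v<nj , x∈T′ with shift-backward u nj v ni l x nk x∈T′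
...   | M , M+l*v≡x , M∈S =
  M , (positive-of-shift u nj v ni l M nk 0<ni (subst (0 <_) (sym M+l*v≡x) 0<x) M∈S , u , v , M∈S) ,
  subst (λ y → + M ≡ toS nj (suc l) y) M+l*v≡x
    (toS[M+l*v]≡M nj M l v (subst (λ y → rem (- (+ y)) nj ≡ v) (sym M+l*v≡x)
      (rem-neg-of-rep ni l x u nj⊥nk nj∣ v<nj (sym x∈T′))))

proposition2p2 : (ni nj nk : ℕ) → ni > 0 → nj > 0 → nk > 0 →
  Coprime ni nj → Coprime nj nk → Coprime ni nk →
  ¬ InMonoid2 nj nk ni → ¬ InMonoid2 ni nk nj → ¬ InMonoid2 ni nj nk →
  (λij λik : ℕ) →
  λij < nk → nk ∣ ni + λij * nj →
  λik < nj → nj ∣ ni + λik * nk →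
  let Ni : ℤ
      Ni = (+ nj) ℤ.* (+ nk) ℤ.- (+ λij) ℤ.* (+ nj) ℤ.- (+ nk)
  in ((M : ℕ) → (M > 0 × InMonoid2 nj ni (M * nk))
        → ∃ λ x → (x > 0 × InMonoid2ℤ nj Ni (x * nk))
          × (+ M ≡ (+ x) ℤ.- ((+ λik) ℤ.- (+ 1)) ℤ.* (+ rem (- (+ x)) nj)))
     × ((x : ℕ) → (x > 0 × InMonoid2ℤ nj Ni (x * nk))
        → ∃ λ M → (M > 0 × InMonoid2 nj ni (M * nk))
          × (+ M ≡ (+ x) ℤ.- ((+ λik) ℤ.- (+ 1)) ℤ.* (+ rem (- (+ x)) nj)))
proposition2p2 ni nj nk _ _ _ ni⊥nj _ _ ni∉⟨nj,nk⟩ _ _ _ zero _ _ _ nj∣ni+0 =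
  ⊥-elim (ni∉⟨nj,nk⟩ (coprime-divisor⇒InMonoid2 ni⊥nj (subst (nj ∣_) (+-identityʳ ni) nj∣ni+0)))
proposition2p2 ni nj nk 0<ni 0<nj 0<nk _ nj⊥nk _ ni∉⟨nj,nk⟩ _ _ λij (suc l) λij<nk nk∣ λik<nj nj∣ =
  (λ M (0<M , M∈S) → let x , (0<x , x∈T) , M≡ = S⇒T {l = l} nj⊥nk nj∣ 0<M M∈S
                     in x , (0<x , toNi x∈T) , M≡) ,
  (λ x (0<x , x∈T) → T⇒S {l = l} 0<ni nj⊥nk nj∣ 0<x (fromNi x∈T))
  where
  instance
    nj≢0 : NonZero nj
    nj≢0 = >-nonZero 0<nj
    nk≢0 : NonZero nk
    nk≢0 = >-nonZero 0<nk
  Ni : ℤ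
  Ni = + nj ℤ.* + nk ℤ.- + λij ℤ.* + nj ℤ.- + nk
  Ni≡ : Ni ≡ + (ni + l * nk)
  Ni≡ = a*b-c*a-b≡n+l*b ni nj nk λij l
          (ni+λij*nj+λik*nk≡nj*nk 0<ni nj⊥nk ni∉⟨nj,nk⟩ λij<nk nk∣ λik<nj nj∣)
  toNi : ∀ {m} → InMonoid2 nj (ni + l * nk) m → InMonoid2ℤ nj Ni m
  toNi {m} = subst (λ N → InMonoid2ℤ nj N m) (sym Ni≡) ∘ InMonoid2⇒InMonoid2ℤ
  fromNi : ∀ {m} → InMonoid2ℤ nj Ni m → InMonoid2 nj (ni + l * nk) m
  fromNi {m} = InMonoid2ℤ⇒InMonoid2 ∘ subst (λ N → InMonoid2ℤ nj N m) Ni≡
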